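{- In STR the following general weakening rule is admissible: if $\Gamma\vdash M:\sigma$ is derivable and $x\notin dom(\Gamma)$, then $\Gamma,x:\tau\vdash M:\sigma$ is derivable for every type $\tau$.
   Context: Terms: $M ::= x \mid \lambda x.M \mid MM$ modulo $\alpha$-equivalence. STR types: linear $A ::= a \mid \sigma\multimap A \mid \forall a.A$, stratified $\sigma ::= A \mid \{\sigma_1,\dots,\sigma_n\}$ ($n\ge1$), modulo renaming of bound type variables and the congruence treating $\{\sigma_1,\dots,\sigma_n\}$ as a finite set (no identification of $\{\sigma\}$ with $\sigma$). Contexts are finite partial maps from term variables to types. Rules ($A,B$ linear): (Ax) $x:A\vdash x:A$; (w) from $\Gamma\vdash M:\sigma$, $x\notin dom(\Gamma)$, infer $\Gamma,x:A\vdash M:\sigma$; ($\multimap$I) from $\Gamma,x:\sigma\vdash M:B$ infer $\Gamma\vdash\lambda x.M:\sigma\multimap B$; ($\multimap$E) from $\Gamma_1\vdash M:\sigma\multimap A$, $\Gamma_2\vdash N:\sigma$ with disjoint domains infer $\Gamma_1,\Gamma_2\vdash MN:A$; (m) from $\Gamma,x_1:\sigma_1,\dots,x_n:\sigma_n\vdash M:\tau$ infer $\Gamma,x:\{\sigma_1,\dots,\sigma_n\}\vdash M[x/x_1,\dots,x/x_n]:\tau$; (st) from $\Gamma_i\vdash M:\sigma_i$ ($1\le i\le n$), all $\Gamma_i$ with the same domain, infer $\bigcup_i\{\Gamma_i\}\vdash M:\{\sigma_1,\dots,\sigma_n\}$, where $(\bigcup_i\{\Gamma_i\})(x)=\{\Gamma_1(x),\dots,\Gamma_n(x)\}$;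 ($\forall$I) from $\Gamma\vdash M:A$, $a$ not free in $\Gamma$, infer $\Gamma\vdash M:\forall a.A$; ($\forall$E) from $\Gamma\vdash M:\forall a.B$ infer $\Gamma\vdash M:B[A/a]$, $A$ linear. -}

module Defs where

open import Data.Nat using (ℕ; zero; suc; _<_; _≡ᵇ_)
open import Data.Bool using (Bool; true; false; if_then_else_; _∨_)
open import Data.Maybe using (Maybe; just; nothing; _<∣>_)
import Data.Maybe as Maybe
open import Data.List using (List; []; _∷_)
open import Data.Bool.ListAction using (any)
open import Data.List.NonEmpty using (List⁺; _∷_; toList; head)
import Data.List.NonEmpty as List⁺
open import Data.List.Relation.Unary.All using (All)
open import Data.List.Relation.Unary.Unique.Propositional using (Unique)
open import Data.Product using (_×_; _,_; proj₁; proj₂; ∃)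
open import Data.Sum using (_⊎_)
open import Relation.Binary.PropositionalEquality using (_≡_)

-- Terms, locally nameless: free variables are names (ℕ), bound variables
-- are de Bruijn indices.  Hence terms are taken modulo α-equivalence.

data Tm : Set where
  fvar : ℕ → Tm
  bvar : ℕ → Tm
  lam  : Tm → Tm
  app  : Tm → Tm → Tm

closeAt : ℕ → ℕ → Tm → Tm
closeAt k x (fvar y) = if y ≡ᵇ x then bvar k else fvar y
closeAt k x (bvar i) = bvar i
closeAt k x (lam M)  = lam (closeAt (suc k) x M)
closeAt k x (app M N) = app (closeAt k x M) (closeAt k x N)

-- λx.M  is  lam (close x M)
close : ℕ → Tm → Tm
close = closeAt 0

rename : (ℕ → ℕ) → Tm → Tm
rename f (fvar y) = fvar (f y)
rename f (bvar i) = bvar i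
rename f (lam M) = lam (rename f M)
rename f (app M N) = app (rename f M) (rename f N)

collapse : ℕ → List ℕ → ℕ → ℕ
collapse x xs y = if any (y ≡ᵇ_) xs then x else y

-- Types, locally nameless in the type variables: free type variables are
-- names (ℕ), ∀-bound ones are de Bruijn indices (so types are modulo
-- renaming of bound type variables).  Stratified sets {σ₁,…,σₙ}, n ≥ 1,
-- are nonempty lists, quotiented below by the set congruence _≈S_.

mutual
  data Lin : Set where
    tfree : ℕ → Lin
    tbound : ℕ → Lin
    _⊸_ : Str → Lin → Lin
    all : Lin → Lin

  data Str : Set where
    lin : Lin → Str
    set : Strs → Str

  data Strs : Set where
    one  : Str → Strs
    cons : Str → Strs → Strs

infixr 30 _⊸_

mutual
  openL : ℕ → Lin → Lin → Lin
  openL k A (tfree a) = tfree a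
  openL k A (tbound i) = if i ≡ᵇ k then A else tbound i
  openL k A (σ ⊸ B) = openS k A σ ⊸ openL k A B
  openL k A (all B) = all (openL (suc k) A B)

  openS : ℕ → Lin → Str → Str
  openS k A (lin B) = lin (openL k A B)
  openS k A (set ss) = set (openSs k A ss)

  openSs : ℕ → Lin → Strs → Strs
  openSs k A (one s) = one (openS k A s)
  openSs k A (cons s ss) = cons (openS k A s) (openSs k A ss)

mutual
  closeL : ℕ → ℕ → Lin → Lin
  closeL k a (tfree b) = if b ≡ᵇ a then tbound k else tfree b
  closeL k a (tbound i) = tbound i
  closeL k a (σ ⊸ B) = closeS k a σ ⊸ closeL k a B
  closeL k a (all B) = all (closeL (suc k) a B)

  closeS : ℕ → ℕ → Str → Str
  closeS k a (lin B) = lin (closeL k a B)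
  closeS k a (set ss) = set (closeSs k a ss)

  closeSs : ℕ → ℕ → Strs → Strs
  closeSs k a (one s) = one (closeS k a s)
  closeSs k a (cons s ss) = cons (closeS k a s) (closeSs k a ss)

-- B[A/a] for ∀a.B  (instantiate the outermost bound variable)
inst : Lin → Lin → Lin
inst B A = openL 0 A B

∀' : ℕ → Lin → Lin
∀' a A = all (closeL 0 a A)

-- local closure (well-formedness of raw types): bound indices < depth
mutual
  data LcL (k : ℕ) : Lin → Set where
    tfree : ∀ a → LcL k (tfree a)
    tbound : ∀ {i} → i < k → LcL k (tbound i)
    _⊸_ : ∀ {σ B} → LcS k σ → LcL k B → LcL k (σ ⊸ B)
    all : ∀ {B} → LcL (suc k) B → LcL k (all B)

  data LcS (k : ℕ) : Str → Set where
    lin : ∀ {A} → LcL k A → LcS k (lin A)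
    set : ∀ {ss} → LcSs k ss → LcS k (set ss)

  data LcSs (k : ℕ) : Strs → Set where
    one : ∀ {s} → LcS k s → LcSs k (one s)
    cons : ∀ {s ss} → LcS k s → LcSs k ss → LcSs k (cons s ss)

LinType : Lin → Set
LinType = LcL 0

Type : Str → Set
Type = LcS 0

mutual
  occL : ℕ → Lin → Bool
  occL a (tfree b) = b ≡ᵇ a
  occL a (tbound i) = false
  occL a (σ ⊸ B) = occS a σ ∨ occL a B
  occL a (all B) = occL a B

  occS : ℕ → Str → Bool
  occS a (lin B) = occL a B
  occS a (set ss) = occSs a ss

  occSs : ℕ → Strs → Bool
  occSs a (one s) = occS a s
  occSs a (cons s ss) = occS a s ∨ occSs a ss

-- The congruence on types: {σ₁,…,σₙ} is a finite set (order and
-- repetitions irrelevant), recursively.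

mutual
  data _≈L_ : Lin → Lin → Set where
    tfree : ∀ a → tfree a ≈L tfree a
    tbound : ∀ i → tbound i ≈L tbound i
    _⊸_ : ∀ {σ σ' B B'} → σ ≈S σ' → B ≈L B' → (σ ⊸ B) ≈L (σ' ⊸ B')
    all : ∀ {B B'} → B ≈L B' → all B ≈L all B'

  data _≈S_ : Str → Str → Set where
    lin : ∀ {A A'} → A ≈L A' → lin A ≈S lin A'
    set : ∀ {ss ts} → ss ⊑ ts → ts ⊑ ss → set ss ≈S set ts

  data _⊑_ : Strs → Strs → Set where
    one : ∀ {s ts} → s ∈≈ ts → one s ⊑ ts
    cons : ∀ {s ss ts} → s ∈≈ ts → ss ⊑ ts → cons s ss ⊑ ts

  data _∈≈_ : Str → Strs → Set where
    here₁ : ∀ {s t} → s ≈S t → s ∈≈ one t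
    here : ∀ {s t ts} → s ≈S t → s ∈≈ cons t ts
    there : ∀ {s t ts} → s ∈≈ ts → s ∈≈ cons t ts

-- Contexts: finite partial maps from term variables to stratified types,
-- represented as functions ℕ → Maybe Str, taken up to pointwise ≈.

Ctx : Set
Ctx = ℕ → Maybe Str

∅ : Ctx
∅ _ = nothing

_∉dom_ : ℕ → Ctx → Set
x ∉dom Γ = Γ x ≡ nothing

_,_∶_ : Ctx → ℕ → Str → Ctx
(Γ , x ∶ σ) y = if y ≡ᵇ x then just σ else Γ y

infixl 5 _,_∶_

extend : Ctx → List (ℕ × Str) → Ctx
extend Γ [] = Γ
extend Γ ((x , σ) ∷ ps) = extend (Γ , x ∶ σ) ps

Disjoint : Ctx → Ctx → Set
Disjoint Γ Δ = ∀ x → Γ x ≡ nothing ⊎ Δ x ≡ nothing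

-- Γ₁ , Γ₂  (for disjoint domains)
_⊹_ : Ctx → Ctx → Ctx
(Γ ⊹ Δ) x = Γ x <∣> Δ x

SameDom : Ctx → Ctx → Set
SameDom Γ Δ = ∀ x → (Γ x ≡ nothing → Δ x ≡ nothing) × (Δ x ≡ nothing → Γ x ≡ nothing)

collect : Maybe Str → List (Maybe Str) → Maybe Strs
collect nothing _ = nothing
collect (just s) [] = just (one s)
collect (just s) (m ∷ ms) = Maybe.map (cons s) (collect m ms)

⋃ : List⁺ Ctx → Ctx
⋃ (Γ ∷ Γs) x = Maybe.map set (collect (Γ x) (Data.List.map (λ Δ → Δ x) Γs))

toStrs : Str → List Str → Strs
toStrs s [] = one s
toStrs s (t ∷ ts) = cons s (toStrs t ts)

setOf : List⁺ Str → Str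
setOf (s ∷ ss) = set (toStrs s ss)

data _≈M_ : Maybe Str → Maybe Str → Set where
  nothing : nothing ≈M nothing
  just : ∀ {σ τ} → σ ≈S τ → just σ ≈M just τ

_≈C_ : Ctx → Ctx → Set
Γ ≈C Δ = ∀ x → Γ x ≈M Δ x

-- Judgements are on raw syntax; the rule `conv`
-- expresses that contexts and types are taken modulo the congruences
-- (finite-map equality of contexts, set congruence of types).

mutual
  data _⊢_∶_ : Ctx → Tm → Str → Set where
    ax : ∀ {x A} → LinType A → (∅ , x ∶ lin A) ⊢ fvar x ∶ lin A
    w  : ∀ {Γ M σ x A} → LinType A → Γ ⊢ M ∶ σ → x ∉dom Γ →
         (Γ , x ∶ lin A) ⊢ M ∶ σ
    ⊸I : ∀ {Γ x σ M B} → x ∉dom Γ → (Γ , x ∶ σ) ⊢ M ∶ lin B →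
         Γ ⊢ lam (close x M) ∶ lin (σ ⊸ B)
    ⊸E : ∀ {Γ₁ Γ₂ M N σ A} → Γ₁ ⊢ M ∶ lin (σ ⊸ A) → Γ₂ ⊢ N ∶ σ →
         Disjoint Γ₁ Γ₂ → (Γ₁ ⊹ Γ₂) ⊢ app M N ∶ lin A
    m  : ∀ {Γ M τ x} (ps : List⁺ (ℕ × Str)) →
         Unique (toList (List⁺.map proj₁ ps)) →
         All (λ p → proj₁ p ∉dom Γ) (toList ps) → x ∉dom Γ →
         extend Γ (toList ps) ⊢ M ∶ τ →
         (Γ , x ∶ setOf (List⁺.map proj₂ ps)) ⊢
           rename (collapse x (toList (List⁺.map proj₁ ps))) M ∶ τ
    st : ∀ {M} (ps : List⁺ (Ctx × Str)) → Prems M (toList ps) →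
         All (λ p → SameDom (proj₁ (head ps)) (proj₁ p)) (toList ps) →
         ⋃ (List⁺.map proj₁ ps) ⊢ M ∶ setOf (List⁺.map proj₂ ps)
    ∀I : ∀ {Γ M A a} → Γ ⊢ M ∶ lin A →
         (∀ y σ → Γ y ≡ just σ → occS a σ ≡ false) →
         Γ ⊢ M ∶ lin (∀' a A)
    ∀E : ∀ {Γ M B A} → Γ ⊢ M ∶ lin (all B) → LinType A →
         Γ ⊢ M ∶ lin (inst B A)
    conv : ∀ {Γ Δ M σ τ} → Γ ⊢ M ∶ σ → Γ ≈C Δ → σ ≈S τ → Δ ⊢ M ∶ τ

  data Prems (M : Tm) : List (Ctx × Str) → Set where
    []  : Prems M []
    _∷_ : ∀ {Γ σ ps} → Γ ⊢ M ∶ σ → Prems M ps → Prems M ((Γ , σ) ∷ ps)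

module Submission where

-- The primitive rule (w) only weakens by a *linear* type.  To weaken by a
-- stratified type {σ₁,…,σₙ} we weaken, by induction on the type, with n
-- fresh variables z₁ : σ₁, …, zₙ : σₙ and then merge them into x with the
-- multiplexing rule (m); the renaming [x/z₁,…,x/zₙ] that (m) performs on
-- the subject is the identity, because the zᵢ do not occur in M.
--
-- Choosing the zᵢ requires names that are fresh for both Γ and M.
-- Contexts are arbitrary maps ℕ → Maybe Str, so we first show that the
-- context of every derivable judgement has a bounded domain; terms have
-- a bound on their free variables by construction.

open import Defs
open import Data.Nat using (ℕ; suc; _≤_; _<_; _⊔_; _≡ᵇ_)
open import Data.Nat.Properties
  using (≡ᵇ⇒≡; ≤-refl; ≤-trans; <-≤-trans; n≤1+n; m≤n⇒m≤1+n;
         m≤m⊔n; m≤n⊔m; <⇒≢; >⇒≢)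
open import Data.Bool using (true; false; T)
open import Data.Bool.Properties using (¬-not)
open import Data.Bool.ListAction using (any)
open import Data.Unit using (tt)
open import Data.Maybe using (nothing)
open import Data.List using (List; []; _∷_)
open import Data.List.NonEmpty using (List⁺; _∷_; _∷⁺_; toList)
import Data.List.NonEmpty as List⁺
open import Data.List.Relation.Unary.All using (All; []; _∷_)
import Data.List.Relation.Unary.All as All
open import Data.List.Relation.Unary.All.Properties using (map⁻)
open import Data.List.Relation.Unary.Unique.Propositional using (Unique)
open import Data.List.Relation.Unary.AllPairs using ([]; _∷_)
open import Data.Product using (_×_; _,_; proj₁; proj₂; ∃)
open import Relation.Binary.PropositionalEquality

≢⇒≡ᵇ-false : ∀ {y x} → y ≢ x → (y ≡ᵇ x) ≡ false
≢⇒≡ᵇ-false {y} {x} y≢x =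
  ¬-not (λ eq → y≢x (≡ᵇ⇒≡ y x (subst T (sym eq) tt)))

extend-other : ∀ Γ {x σ} y → y ≢ x → (Γ , x ∶ σ) y ≡ Γ y
extend-other Γ {x} y y≢x rewrite ≢⇒≡ᵇ-false {y} {x} y≢x = refl

extend-∉dom : ∀ Γ {x σ} y → y ∉dom (Γ , x ∶ σ) → y ∉dom Γ
extend-∉dom Γ {x} y y∉ with y ≡ᵇ x
... | false = y∉
... | true with () ← y∉

FreshFrom : Ctx → ℕ → Set
FreshFrom Γ n = ∀ y → n ≤ y → y ∉dom Γ

freshFrom-mono : ∀ {Γ k n} → k ≤ n → FreshFrom Γ k → FreshFrom Γ n
freshFrom-mono k≤n fresh y n≤y = fresh y (≤-trans k≤n n≤y)

freshFrom-, : ∀ {Γ x σ n} → x < n → FreshFrom Γ n → FreshFrom (Γ , x ∶ σ) n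
freshFrom-, {Γ} {x} x<n fresh y n≤y =
  trans (extend-other Γ y (>⇒≢ (<-≤-trans x<n n≤y))) (fresh y n≤y)

freshFrom-,⊔ : ∀ {Γ x σ n} → FreshFrom Γ n → FreshFrom (Γ , x ∶ σ) (n ⊔ suc x)
freshFrom-,⊔ {x = x} {n = n} fresh =
  freshFrom-, (m≤n⊔m n (suc x)) (freshFrom-mono (m≤m⊔n n (suc x)) fresh)

freshFrom-,⁻ : ∀ {Γ x σ n} → FreshFrom (Γ , x ∶ σ) n → FreshFrom Γ n
freshFrom-,⁻ {Γ} fresh y n≤y = extend-∉dom Γ y (fresh y n≤y)

freshFrom-extend⁻ : ∀ {Γ n} ps → FreshFrom (extend Γ ps) n → FreshFrom Γ n
freshFrom-extend⁻ []             fresh = fresh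
freshFrom-extend⁻ ((x , σ) ∷ ps) fresh = freshFrom-,⁻ (freshFrom-extend⁻ ps fresh)

freshFrom-⊹ : ∀ {Γ Δ k n} → FreshFrom Γ k → FreshFrom Δ n → FreshFrom (Γ ⊹ Δ) (k ⊔ n)
freshFrom-⊹ {k = k} {n} freshΓ freshΔ y le
  rewrite freshΓ y (≤-trans (m≤m⊔n k n) le)
        | freshΔ y (≤-trans (m≤n⊔m k n) le) = refl

freshFrom-⋃ : ∀ {Γ Γs n} → FreshFrom Γ n → FreshFrom (⋃ (Γ ∷ Γs)) n
freshFrom-⋃ fresh y le rewrite fresh y le = refl

≈M-nothing : ∀ {a b} → a ≈M b → a ≡ nothing → b ≡ nothing
≈M-nothing nothing refl = refl

freshFrom-≈ : ∀ {Γ Δ n} → Γ ≈C Δ → FreshFrom Γ n → FreshFrom Δ n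
freshFrom-≈ Γ≈Δ fresh y le = ≈M-nothing (Γ≈Δ y) (fresh y le)

-- The domain of a derivable context is bounded: every rule builds its
-- context from those of its premises by finitely many extensions,
-- unions and restrictions.
derivable⇒bounded : ∀ {Γ M σ} → Γ ⊢ M ∶ σ → ∃ (FreshFrom Γ)
derivable⇒bounded (ax {x} _) = suc x , freshFrom-, {∅} ≤-refl (λ _ _ → refl)
derivable⇒bounded (w _ d _) with derivable⇒bounded d
... | n , fresh = _ , freshFrom-,⊔ fresh
derivable⇒bounded (⊸I _ d) with derivable⇒bounded d
... | n , fresh = n , freshFrom-,⁻ fresh
derivable⇒bounded (⊸E d₁ d₂ _) with derivable⇒bounded d₁ | derivable⇒bounded d₂
... | n₁ , fresh₁ | n₂ , fresh₂ = n₁ ⊔ n₂ , freshFrom-⊹ fresh₁ fresh₂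
derivable⇒bounded (m ps _ _ _ d) with derivable⇒bounded d
... | n , fresh = _ , freshFrom-,⊔ (freshFrom-extend⁻ (toList ps) fresh)
derivable⇒bounded (st (_ ∷ _) (d ∷ _) _) with derivable⇒bounded d
... | n , fresh = n , freshFrom-⋃ fresh
derivable⇒bounded (∀I d _) = derivable⇒bounded d
derivable⇒bounded (∀E d _) = derivable⇒bounded d
derivable⇒bounded (conv d Γ≈Δ _) with derivable⇒bounded d
... | n , fresh = n , freshFrom-≈ Γ≈Δ fresh

freeBound : Tm → ℕ
freeBound (fvar y)  = suc y
freeBound (bvar _)  = 0
freeBound (lam M)   = freeBound M
freeBound (app M N) = freeBound M ⊔ freeBound N

rename-fixes : ∀ f M → (∀ y → y < freeBound M → f y ≡ y) → rename f M ≡ M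
rename-fixes f (fvar y)  fixes = cong fvar (fixes y ≤-refl)
rename-fixes f (bvar i)  fixes = refl
rename-fixes f (lam M)   fixes = cong lam (rename-fixes f M fixes)
rename-fixes f (app M N) fixes = cong₂ app
  (rename-fixes f M (λ y lt → fixes y (<-≤-trans lt (m≤m⊔n (freeBound M) (freeBound N)))))
  (rename-fixes f N (λ y lt → fixes y (<-≤-trans lt (m≤n⊔m (freeBound M) (freeBound N)))))

any-≡ᵇ-false : ∀ {y} zs → All (y ≢_) zs → any (y ≡ᵇ_) zs ≡ false
any-≡ᵇ-false []       []           = refl
any-≡ᵇ-false (z ∷ zs) (y≢z ∷ y∉zs) rewrite ≢⇒≡ᵇ-false y≢z = any-≡ᵇ-false zs y∉zs

collapse-other : ∀ x zs y → All (y ≢_) zs → collapse x zs y ≡ y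
collapse-other x zs y y∉zs rewrite any-≡ᵇ-false zs y∉zs = refl

freshDecls : ℕ → Strs → List⁺ (ℕ × Str)
freshDecls n (one s)     = (n , s) ∷ []
freshDecls n (cons s ss) = (n , s) ∷⁺ freshDecls (suc n) ss

freshNames : ℕ → Strs → List ℕ
freshNames n ss = toList (List⁺.map proj₁ (freshDecls n ss))

freshNames-≥ : ∀ {k} n ss → k ≤ n → All (k ≤_) (freshNames n ss)
freshNames-≥ n (one s)     k≤n = k≤n ∷ []
freshNames-≥ n (cons s ss) k≤n = k≤n ∷ freshNames-≥ (suc n) ss (m≤n⇒m≤1+n k≤n)

freshNames-unique : ∀ n ss → Unique (freshNames n ss)
freshNames-unique n (one s)     = [] ∷ []
freshNames-unique n (cons s ss) =
  All.map <⇒≢ (freshNames-≥ (suc n) ss ≤-refl) ∷ freshNames-unique (suc n) ss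

set-injective : ∀ {ss ts : Strs} → set ss ≡ set ts → ss ≡ ts
set-injective refl = refl

setOf-freshDecls : ∀ n ss → setOf (List⁺.map proj₂ (freshDecls n ss)) ≡ set ss
setOf-freshDecls n (one s)     = refl
setOf-freshDecls n (cons s ss) =
  cong (λ ts → set (cons s ts)) (set-injective (setOf-freshDecls (suc n) ss))

merge-fresh : ∀ {Γ M σ x k} ss → FreshFrom Γ k → freeBound M ≤ k → x ∉dom Γ →
              extend Γ (toList (freshDecls k ss)) ⊢ M ∶ σ →
              (Γ , x ∶ set ss) ⊢ M ∶ σ
merge-fresh {Γ} {M} {σ} {x} {k} ss fresh M≤k x∉ d =
  subst₂ (λ τ N → (Γ , x ∶ τ) ⊢ N ∶ σ)
    (setOf-freshDecls k ss) (rename-fixes _ M collapse-fixes)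
    (m (freshDecls k ss) (freshNames-unique k ss) decls-fresh x∉ d)
  where
  decls-fresh : All (λ p → proj₁ p ∉dom Γ) (toList (freshDecls k ss))
  decls-fresh = All.map (fresh _) (map⁻ (freshNames-≥ k ss ≤-refl))

  collapse-fixes : ∀ y → y < freeBound M → collapse x (freshNames k ss) y ≡ y
  collapse-fixes y y<M = collapse-other x (freshNames k ss) y
    (All.map (λ k≤z → <⇒≢ (<-≤-trans y<M (≤-trans M≤k k≤z))) (freshNames-≥ k ss ≤-refl))

mutual
  weaken : ∀ {Γ M σ x τ} → Type τ → Γ ⊢ M ∶ σ → x ∉dom Γ → (Γ , x ∶ τ) ⊢ M ∶ σ
  weaken (lin A)  d x∉ = w A d x∉
  -- A set type is added through fresh names above both Γ and M.
  weaken {Γ} {M} (set {ss} ps) d x∉ =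
    merge-fresh ss fresh-k (m≤n⊔m n (freeBound M)) x∉ (weakenFresh ps d fresh-k)
    where
    n : ℕ
    n = proj₁ (derivable⇒bounded d)

    fresh-k : FreshFrom Γ (n ⊔ freeBound M)
    fresh-k = freshFrom-mono (m≤m⊔n n (freeBound M)) (proj₂ (derivable⇒bounded d))

  weakenFresh : ∀ {Γ M σ n ss} → LcSs 0 ss → Γ ⊢ M ∶ σ → FreshFrom Γ n →
                extend Γ (toList (freshDecls n ss)) ⊢ M ∶ σ
  weakenFresh {n = n} (one p) d fresh = weaken p d (fresh n ≤-refl)
  weakenFresh {n = n} (cons p ps) d fresh =
    weakenFresh ps (weaken p d (fresh n ≤-refl))
      (freshFrom-, ≤-refl (freshFrom-mono (n≤1+n n) fresh))

mainTheorem12 : ∀ {Γ : Ctx} {M : Tm} {σ : Str} {x : ℕ} {τ : Str} →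
    Γ ⊢ M ∶ σ → x ∉dom Γ → Type τ → (Γ , x ∶ τ) ⊢ M ∶ σ
mainTheorem12 d x∉ τ-type = weaken τ-type d x∉
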